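{- For every $r$-coloured permutation $\bm a$ of length $n$, $$\Psi(F_{\bm a})=\frac{\bm p^{\mathbf{col}(\bm a)}x^{\mathrm{comaj}(\bm a)}t^{\mathrm{des}(\bm a)}}{(1-t)(1-xt)\cdots(1-x^nt)}.$$
   Context: Fix $r\ge1$. An $r$-coloured permutation is a word $\bm a=\sigma_1^{\gamma_1}\cdots\sigma_n^{\gamma_n}$ ($n\ge0$) with distinct positive integers $\sigma_i$ and colours $\gamma_i\in\{0,\dots,r-1\}$. Coloured integers are ordered by $\sigma_1^{\gamma_1}<\sigma_2^{\gamma_2}$ iff either $\gamma_1=\gamma_2$ and $\sigma_1<\sigma_2$, or $\gamma_1>\gamma_2$ as integers. $\mathrm{Des}(\bm a)=\{i\in[n-1]:\sigma_i^{\gamma_i}>\sigma_{i+1}^{\gamma_{i+1}}\}$, with $0$ added if $n\ge1$ and $\gamma_1\ne0$; $\mathrm{Des}^*(\bm a)=\mathrm{Des}(\bm a)\setminus\{0\}$; $\mathrm{des}(\bm a)=|\mathrm{Des}(\bm a)|$; $\mathrm{comaj}(\bm a)=\sum_{i\in\mathrm{Des}(\bm a)}(n-i)$; $\mathbf{col}(\bm a)=(\mathrm{col}_0,\dots,\mathrm{col}_{r-1})$ with $\mathrm{col}_j=|\{i:\gamma_i=j\}|$; $\bm p^{\bm v}=p_0^{v_0}\cdots p_{r-1}^{v_{r-1}}$. With commuting variables $x_i^{(j)}$ ($i\ge1$, $0\le j\le r-1$), $F_{\bm a}=\sum x_{i_1}^{(\gamma_1)}\cdots x_{i_n}^{(\gamma_n)}$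 over $1\le i_1\le\dots\le i_n$ with $i_j<i_{j+1}$ whenever $j\in\mathrm{Des}^*(\bm a)$; $\mathrm{QSym}^{(r)}$ is the $\mathbb{Q}$-algebra spanned by all $F_{\bm a}$. For $m\ge1$, $\psi_m:\mathrm{QSym}^{(r)}\to\mathbb{Q}[p_0,\dots,p_{r-1},x]$ is the specialisation $x_i^{(0)}\mapsto x^{i-1}p_0$ for $1\le i\le m$; $x_i^{(j)}\mapsto x^{i-1}p_j$ for $1<i\le m$ and $1\le j\le r-1$; all other variables $\mapsto0$ (in particular $x_1^{(j)}\mapsto0$ for $j\ge1$). Define $\Psi:\mathrm{QSym}^{(r)}\to\mathbb{Q}[\bm p,x][[t]]$ by $\Psi(F)=\sum_{m\ge1}\psi_m(F)t^{m-1}$. -}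

module Defs where

open import Data.Nat using (ℕ; zero; suc; _∸_; _≤ᵇ_; _<ᵇ_; _≡ᵇ_)
open import Data.Nat.Properties using () renaming (_≟_ to _≟ℕ_)
open import Data.Bool using (Bool; true; false; if_then_else_; _∧_; _∨_; not)
open import Data.Fin using (Fin; toℕ)
open import Data.Fin.Properties using () renaming (_≟_ to _≟F_)
open import Data.Product using (_×_; _,_; proj₁; proj₂)
open import Data.List using (List; []; _∷_; [_]; map; concatMap; foldr; length; upTo; filter; _++_)
open import Data.Nat.ListAction using (sum)
open import Data.Vec using (Vec; []; _∷_; replicate; tabulate; updateAt)
open import Data.Vec.Properties using (≡-dec)
open import Data.Rational using (ℚ; 0ℚ; 1ℚ; _+_; _*_; -_)
open import Relation.Nullary.Decidable using (⌊_⌋)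

-- Polynomials in Q[p_0,…,p_{r-1}, x] as coefficient functions:
-- P v e is the coefficient of p^v x^e.

Poly : ℕ → Set
Poly r = Vec ℕ r → ℕ → ℚ

_≟V_ : ∀ {r} → (u w : Vec ℕ r) → _
_≟V_ = ≡-dec _≟ℕ_

0P : ∀ {r} → Poly r
0P _ _ = 0ℚ

monoP : ∀ {r} → Vec ℕ r → ℕ → Poly r
monoP v e v' e' = if ⌊ v' ≟V v ⌋ ∧ ⌊ e' ≟ℕ e ⌋ then 1ℚ else 0ℚ

1P : ∀ {r} → Poly r
1P = monoP (replicate _ 0) 0

_+P_ : ∀ {r} → Poly r → Poly r → Poly r
(f +P g) v e = f v e + g v e

negP : ∀ {r} → Poly r → Poly r
negP f v e = - f v e

sumℚ : List ℚ → ℚ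
sumℚ = foldr _+_ 0ℚ

splitsℕ : ℕ → List (ℕ × ℕ)
splitsℕ n = map (λ i → i , n ∸ i) (upTo (suc n))

splitsV : ∀ {r} → Vec ℕ r → List (Vec ℕ r × Vec ℕ r)
splitsV [] = [ [] , [] ]
splitsV (x ∷ xs) =
  concatMap (λ ab → map (λ uw → (proj₁ ab ∷ proj₁ uw) , (proj₂ ab ∷ proj₂ uw)) (splitsV xs))
            (splitsℕ x)

_*P_ : ∀ {r} → Poly r → Poly r → Poly r
(f *P g) v e =
  sumℚ (concatMap (λ vv → map (λ ee → f (proj₁ vv) (proj₁ ee) * g (proj₂ vv) (proj₂ ee)) (splitsℕ e))
                  (splitsV v))

prodP : ∀ {r} → List (Poly r) → Poly r
prodP = foldr _*P_ 1P

-- Formal power series in t over Q[p, x]: S k is the coefficient of t^k.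

Series : ℕ → Set
Series r = ℕ → Poly r

sumP : ∀ {r} → List (Poly r) → Poly r
sumP = foldr _+P_ 0P

_*S_ : ∀ {r} → Series r → Series r → Series r
(f *S g) k = sumP (map (λ kk → f (proj₁ kk) *P g (proj₂ kk)) (splitsℕ k))

1S : ∀ {r} → Series r
1S zero = 1P
1S (suc _) = 0P

monoS : ∀ {r} → Vec ℕ r → ℕ → ℕ → Series r
monoS v e d k = if ⌊ k ≟ℕ d ⌋ then monoP v e else 0P

oneMinusXiT : ∀ {r} → ℕ → Series r
oneMinusXiT i zero = 1P
oneMinusXiT i (suc zero) = negP (monoP (replicate _ 0) i)
oneMinusXiT i (suc (suc _)) = 0P

denominator : ∀ {r} → ℕ → Series r
denominator n = foldr _*S_ 1S (map oneMinusXiT (upTo (suc n)))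

-- r-coloured permutations, as lists of letters (σ , γ)

Letter : ℕ → Set
Letter r = ℕ × Fin r

_<c_ : ∀ {r} → Letter r → Letter r → Bool
(s₁ , g₁) <c (s₂ , g₂) = (⌊ g₁ ≟F g₂ ⌋ ∧ (s₁ <ᵇ s₂)) ∨ (toℕ g₂ <ᵇ toℕ g₁)

-- Des*(a): positions i ∈ [n-1] (1-indexed) with a_i > a_{i+1};
-- the argument k is the position of the head letter.
desStarFrom : ∀ {r} → ℕ → List (Letter r) → List ℕ
desStarFrom k [] = []
desStarFrom k (_ ∷ []) = []
desStarFrom k (a ∷ b ∷ w) =
  (if b <c a then [ k ] else []) ++ desStarFrom (suc k) (b ∷ w)

DesStar : ∀ {r} → List (Letter r) → List ℕ
DesStar = desStarFrom 1

Des : ∀ {r} → List (Letter r) → List ℕ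
Des [] = []
Des ((s , g) ∷ w) =
  (if toℕ g ≡ᵇ 0 then [] else [ 0 ]) ++ DesStar ((s , g) ∷ w)

des : ∀ {r} → List (Letter r) → ℕ
des a = length (Des a)

comaj : ∀ {r} → List (Letter r) → ℕ
comaj a = sum (map (λ i → length a ∸ i) (Des a))

col : ∀ {r} → List (Letter r) → Vec ℕ r
col {r} a = tabulate (λ j → length (filter (λ l → proj₂ l Data.Fin.≟ j) a))

unitV : ∀ {r} → Fin r → Vec ℕ r
unitV j = updateAt (replicate _ 0) j (λ _ → 1)

ψvar : ∀ {r} → ℕ → ℕ → Fin r → Poly r
ψvar m i j =
  if (1 ≤ᵇ i) ∧ (i ≤ᵇ m) ∧ ((toℕ j ≡ᵇ 0) ∨ (2 ≤ᵇ i))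
  then monoP (unitV j) (i ∸ 1) else 0P

seqs : ℕ → ℕ → List (List ℕ)
seqs m zero = [ [] ]
seqs m (suc n) = concatMap (λ i → map (i ∷_) (seqs m n)) (map suc (upTo m))

compatible : ∀ {r} → List (Letter r) → List ℕ → Bool
compatible (a ∷ b ∷ w) (i ∷ i' ∷ is) =
  (if b <c a then i <ᵇ i' else i ≤ᵇ i') ∧ compatible (b ∷ w) (i' ∷ is)
compatible _ _ = true

ψmon : ∀ {r} → ℕ → List (Letter r) → List ℕ → Poly r
ψmon m (a ∷ w) (i ∷ is) = ψvar m i (proj₂ a) *P ψmon m w is
ψmon m _ _ = 1P

-- ψ_m(F_a): the monomials of F_a with some index > m vanish under ψ_m,
-- so only sequences with entries in [1..m] contribute.
ψF : ∀ {r} → ℕ → List (Letter r) → Poly r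
ψF m a = sumP (map (ψmon m a) (filter (λ s → compatible a s Data.Bool.≟ true) (seqs m (length a))))

-- Ψ(F_a) = Σ_{m ≥ 1} ψ_m(F_a) t^{m-1}
ΨF : ∀ {r} → List (Letter r) → Series r
ΨF a k = ψF (suc k) a

module Submission where

-- All polynomials that occur have a single monomial in p, so after factoring out p^col(a) the identity
-- lives in ℚ[x][[t]]. Here ψ_m(F_a) is a sum of x^{Σ (iⱼ − 1)} over index sequences 1 ≤ i₁ ≤ ⋯ ≤ iₙ ≤ m
-- compatible with a; killing x₁^{(γ)} for γ ≠ 0 forbids i₁ = 1 when the first letter is coloured and
-- excludes nothing else, since compatibility already keeps later coloured letters off index 1.
-- Splitting off the sequences with i₁ = 1 and raising the indices of the others by one (which multiplies
-- their weight by xⁿ) gives G = Q + xⁿ t G for the generating series G of a word of length n, where Q is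
-- the series of the word without its first letter, whose first index is forced up to 2 exactly at a
-- descent. Hence (1 − xⁿ t) G = Q, and induction on the word peels off the factors of the denominator,
-- each descent at position i contributing t x^{n−i}.

open import Level using (0ℓ)
open import Algebra.Bundles using (CommutativeSemiring; CommutativeRing; CommutativeMonoid)
open import Algebra.Structures.Biased using (isCommutativeSemiringˡ)
open import Data.Nat as ℕ using (ℕ; zero; suc; _∸_; _≤_; _≤ᵇ_; _<ᵇ_; _≡ᵇ_)
import Data.Nat.Properties as ℕ
open import Data.Bool using (Bool; true; false; if_then_else_; _∧_; _∨_; not)
open import Data.Fin as Fin using (Fin; toℕ)
import Data.Fin.Properties as Fin
open import Data.Fin.Permutation using (reverse; _⟨$⟩ʳ_)
open import Data.Product using (_×_; _,_; proj₁; proj₂)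
open import Data.List using (List; []; _∷_; [_]; map; concatMap; foldr; length; upTo; applyUpTo; filter; _++_)
open import Data.Empty using (⊥-elim)
open import Function using (_∘_)
open import Relation.Binary.Bundles using (Setoid)
open import Relation.Binary.Structures using (IsEquivalence)
open import Relation.Binary.PropositionalEquality as ≡ using (_≡_; _≢_)
open import Relation.Nullary.Decidable using (⌊_⌋; yes; no)

module FormalPowerSeries {c ℓ} (R : CommutativeSemiring c ℓ) where

  open CommutativeSemiring R
  open import Algebra.Properties.CommutativeMonoid.Sum +-commutativeMonoid
    using (sum; sum-syntax; sum⁺-syntax; sum-cong-≋; sum-replicate-zero; ∑-distrib-+; ∑-permute)
  open import Algebra.Properties.Semiring.Sum semiring using (*-distribˡ-sum)
  import Relation.Binary.Reasoning.Setoid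
  module ≈-Reasoning = Relation.Binary.Reasoning.Setoid setoid

  Series : Set c
  Series = ℕ → Carrier

  infix 4 _≋_
  _≋_ : Series → Series → Set ℓ
  f ≋ g = ∀ k → f k ≈ g k

  ≋-isEquivalence : IsEquivalence _≋_
  ≋-isEquivalence = record
    { refl = λ _ → refl ; sym = λ p k → sym (p k) ; trans = λ p q k → trans (p k) (q k) }

  ≋-setoid : Setoid c ℓ
  ≋-setoid = record { isEquivalence = ≋-isEquivalence }

  open IsEquivalence ≋-isEquivalence public
    using () renaming (refl to ≋-refl; sym to ≋-sym; trans to ≋-trans)

  module ≋-Reasoning = Relation.Binary.Reasoning.Setoid ≋-setoid

  sum-zero : ∀ {n} {f : Fin n → Carrier} → (∀ i → f i ≈ 0#) → sum f ≈ 0#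
  sum-zero {n} p = trans (sum-cong-≋ p) (sum-replicate-zero n)

  infixl 6 _⊕_
  infixr 7 _·_ _⊛_

  𝟘 : Series
  𝟘 _ = 0#

  _⊕_ : Series → Series → Series
  (f ⊕ g) k = f k + g k

  _·_ : Carrier → Series → Series
  (x · f) k = x * f k

  _⊛_ : Series → Series → Series
  (f ⊛ g) k = ∑[ i ≤ k ] (f (toℕ i) * g (k ∸ toℕ i))

  ι : Carrier → Series
  ι x zero = x
  ι x (suc _) = 0#

  𝟙 : Series
  𝟙 = ι 1#

  delay : ℕ → Series → Series
  delay zero f = f
  delay (suc n) f zero = 0#
  delay (suc n) f (suc k) = delay n f k

  monomial : ℕ → Carrier → Series
  monomial n x = delay n (ι x)

  monomial-apply : ∀ n x k → monomial n x k ≡ (if ⌊ k ℕ.≟ n ⌋ then x else 0#)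
  monomial-apply n x k with k ℕ.≟ n
  ... | yes ≡.refl = diagonal n
    where
    diagonal : ∀ n → monomial n x n ≡ x
    diagonal zero = ≡.refl
    diagonal (suc n) = diagonal n
  ... | no k≢n = offDiagonal n k k≢n
    where
    offDiagonal : ∀ n k → k ≢ n → monomial n x k ≡ 0#
    offDiagonal zero zero 0≢0 = ⊥-elim (0≢0 ≡.refl)
    offDiagonal zero (suc k) _ = ≡.refl
    offDiagonal (suc n) zero _ = ≡.refl
    offDiagonal (suc n) (suc k) k≢n = offDiagonal n k (k≢n ∘ ≡.cong suc)

  ⊛-cong : ∀ {f f′ g g′} → f ≋ f′ → g ≋ g′ → f ⊛ g ≋ f′ ⊛ g′
  ⊛-cong p q k = sum-cong-≋ {suc k} (λ i → *-cong (p (toℕ i)) (q (k ∸ toℕ i)))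

  ⊛-congˡ : ∀ {f g g′} → g ≋ g′ → f ⊛ g ≋ f ⊛ g′
  ⊛-congˡ {f} = ⊛-cong {f} (λ _ → refl)

  ⊛-congʳ : ∀ {f f′ g} → f ≋ f′ → f ⊛ g ≋ f′ ⊛ g
  ⊛-congʳ {g = g} p = ⊛-cong {g = g} p (λ _ → refl)

  ⊛-comm : ∀ f g → f ⊛ g ≋ g ⊛ f
  ⊛-comm f g k = begin
    ∑[ i ≤ k ] (f (toℕ i) * g (k ∸ toℕ i))
      ≈⟨ ∑-permute {suc k} {suc k} (λ i → f (toℕ i) * g (k ∸ toℕ i)) reverse ⟩
    ∑[ i ≤ k ] (f (toℕ (reverse ⟨$⟩ʳ i)) * g (k ∸ toℕ (reverse ⟨$⟩ʳ i)))
      ≈⟨ sum-cong-≋ {suc k} reflect ⟩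
    ∑[ i ≤ k ] (g (toℕ i) * f (k ∸ toℕ i)) ∎
    where
    open ≈-Reasoning
    reflect : ∀ (i : Fin (suc k)) →
      f (toℕ (reverse ⟨$⟩ʳ i)) * g (k ∸ toℕ (reverse ⟨$⟩ʳ i)) ≈ g (toℕ i) * f (k ∸ toℕ i)
    reflect i rewrite Fin.opposite-prop i | ℕ.m∸[m∸n]≡n (Fin.toℕ≤pred[n] i) = *-comm _ _

  ⊛-distribʳ : ∀ f g h → (g ⊕ h) ⊛ f ≋ g ⊛ f ⊕ h ⊛ f
  ⊛-distribʳ f g h k =
    trans (sum-cong-≋ {suc k} (λ i → distribʳ (f (k ∸ toℕ i)) (g (toℕ i)) (h (toℕ i))))
          (∑-distrib-+ {suc k} (λ i → g (toℕ i) * f (k ∸ toℕ i))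
                               (λ i → h (toℕ i) * f (k ∸ toℕ i)))

  ⊛-zeroˡ : ∀ f → 𝟘 ⊛ f ≋ 𝟘
  ⊛-zeroˡ f k = sum-zero {suc k} (λ i → zeroˡ (f (k ∸ toℕ i)))

  ⊛-·ˡ : ∀ x f g → (x · f) ⊛ g ≋ x · (f ⊛ g)
  ⊛-·ˡ x f g k =
    trans (sum-cong-≋ {suc k} (λ i → *-assoc x (f (toℕ i)) (g (k ∸ toℕ i))))
          (sym (*-distribˡ-sum {suc k} x (λ i → f (toℕ i) * g (k ∸ toℕ i))))

  ι-⊛ : ∀ x f → ι x ⊛ f ≋ x · f
  ι-⊛ x f zero = +-identityʳ _
  ι-⊛ x f (suc k) =
    trans (+-congˡ (sum-zero {suc k} (λ i → zeroˡ (f (k ∸ toℕ i))))) (+-identityʳ _)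

  ⊛-identityˡ : ∀ f → 𝟙 ⊛ f ≋ f
  ⊛-identityˡ f k = trans (ι-⊛ 1# f k) (*-identityˡ (f k))

  ⊛-assoc : ∀ f g h → (f ⊛ g) ⊛ h ≋ f ⊛ (g ⊛ h)
  ⊛-assoc f g h zero = begin
    ((f 0 * g 0 + 0#) * h 0) + 0# ≈⟨ +-congʳ (*-congʳ (+-identityʳ _)) ⟩
    (f 0 * g 0) * h 0 + 0#        ≈⟨ +-congʳ (*-assoc _ _ _) ⟩
    f 0 * (g 0 * h 0) + 0#        ≈⟨ +-congʳ (*-congˡ (+-identityʳ _)) ⟨
    f 0 * (g 0 * h 0 + 0#) + 0#   ∎
    where open ≈-Reasoning
  ⊛-assoc f g h (suc k) = begin
    (f 0 * g 0 + 0#) * h (suc k) + ((λ i → (f ⊛ g) (suc i)) ⊛ h) k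
      ≈⟨ +-congʳ (*-congʳ (+-identityʳ _)) ⟩
    (f 0 * g 0) * h (suc k) + ((f 0 · (g ∘ suc) ⊕ (f ∘ suc) ⊛ g) ⊛ h) k
      ≈⟨ +-cong (*-assoc _ _ _) (⊛-distribʳ h (f 0 · (g ∘ suc)) (f ∘ suc ⊛ g) k) ⟩
    f 0 * (g 0 * h (suc k)) + (((f 0 · (g ∘ suc)) ⊛ h) k + ((f ∘ suc ⊛ g) ⊛ h) k)
      ≈⟨ +-congˡ (+-cong (⊛-·ˡ (f 0) (g ∘ suc) h k) (⊛-assoc (f ∘ suc) g h k)) ⟩
    f 0 * (g 0 * h (suc k)) + (f 0 * ((g ∘ suc) ⊛ h) k + (f ∘ suc ⊛ (g ⊛ h)) k)
      ≈⟨ +-assoc _ _ _ ⟨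
    (f 0 * (g 0 * h (suc k)) + f 0 * ((g ∘ suc) ⊛ h) k) + (f ∘ suc ⊛ (g ⊛ h)) k
      ≈⟨ +-congʳ (distribˡ (f 0) _ _) ⟨
    f 0 * (g ⊛ h) (suc k) + (f ∘ suc ⊛ (g ⊛ h)) k ∎
    where open ≈-Reasoning

  delay-cong : ∀ n {f g} → f ≋ g → delay n f ≋ delay n g
  delay-cong zero p k = p k
  delay-cong (suc n) p zero = refl
  delay-cong (suc n) p (suc k) = delay-cong n p k

  delay-+ : ∀ m n f → delay m (delay n f) ≋ delay (m ℕ.+ n) f
  delay-+ zero n f k = refl
  delay-+ (suc m) n f zero = refl
  delay-+ (suc m) n f (suc k) = delay-+ m n f k

  delay-⊕ : ∀ n f g → delay n (f ⊕ g) ≋ delay n f ⊕ delay n g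
  delay-⊕ zero f g k = refl
  delay-⊕ (suc n) f g zero = sym (+-identityʳ 0#)
  delay-⊕ (suc n) f g (suc k) = delay-⊕ n f g k

  delay-𝟘 : ∀ n → delay n 𝟘 ≋ 𝟘
  delay-𝟘 zero k = refl
  delay-𝟘 (suc n) zero = refl
  delay-𝟘 (suc n) (suc k) = delay-𝟘 n k

  ·-delay : ∀ x n f → x · delay n f ≋ delay n (x · f)
  ·-delay x zero f k = refl
  ·-delay x (suc n) f zero = zeroʳ x
  ·-delay x (suc n) f (suc k) = ·-delay x n f k

  delay-⊛ : ∀ n f g → delay n f ⊛ g ≋ delay n (f ⊛ g)
  delay-⊛ zero f g k = refl
  delay-⊛ (suc n) f g zero = trans (+-identityʳ _) (zeroˡ (g 0))
  delay-⊛ (suc n) f g (suc k) =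
    trans (+-congʳ (zeroˡ (g (suc k)))) (trans (+-identityˡ _) (delay-⊛ n f g k))

  ·-ι : ∀ x y → x · ι y ≋ ι (x * y)
  ·-ι x y zero = refl
  ·-ι x y (suc k) = zeroʳ x

  monomial-cong : ∀ n {x y} → x ≈ y → monomial n x ≋ monomial n y
  monomial-cong n p = delay-cong n λ { zero → p ; (suc k) → refl }

  monomial-⊛ : ∀ n x f → monomial n x ⊛ f ≋ delay n (x · f)
  monomial-⊛ n x f = ≋-trans (delay-⊛ n (ι x) f) (delay-cong n (ι-⊛ x f))

  monomial-⊛-monomial : ∀ m x n y → monomial m x ⊛ monomial n y ≋ monomial (m ℕ.+ n) (x * y)
  monomial-⊛-monomial m x n y = begin
    monomial m x ⊛ monomial n y    ≈⟨ monomial-⊛ m x (monomial n y) ⟩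
    delay m (x · delay n (ι y))    ≈⟨ delay-cong m (·-delay x n (ι y)) ⟩
    delay m (delay n (x · ι y))    ≈⟨ delay-cong m (delay-cong n (·-ι x y)) ⟩
    delay m (delay n (ι (x * y)))  ≈⟨ delay-+ m n _ ⟩
    monomial (m ℕ.+ n) (x * y)       ∎
    where open ≋-Reasoning

  ⊛-zeroʳ : ∀ f → f ⊛ 𝟘 ≋ 𝟘
  ⊛-zeroʳ f = ≋-trans (⊛-comm f 𝟘) (⊛-zeroˡ f)

  ⊛-·ʳ : ∀ x f g → f ⊛ (x · g) ≋ x · (f ⊛ g)
  ⊛-·ʳ x f g = ≋-trans (⊛-comm f (x · g)) (≋-trans (⊛-·ˡ x g f) (λ k → *-congˡ (⊛-comm g f k)))

  ⊛-identityʳ : ∀ f → f ⊛ 𝟙 ≋ f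
  ⊛-identityʳ f = ≋-trans (⊛-comm f 𝟙) (⊛-identityˡ f)

  ⊛-commutativeSemiring : CommutativeSemiring c ℓ
  ⊛-commutativeSemiring = record
    { Carrier = Series ; _≈_ = _≋_ ; _+_ = _⊕_ ; _*_ = _⊛_ ; 0# = 𝟘 ; 1# = 𝟙
    ; isCommutativeSemiring = isCommutativeSemiringˡ record
      { +-isCommutativeMonoid = record
        { isMonoid = record
          { isSemigroup = record
            { isMagma = record
              { isEquivalence = ≋-isEquivalence ; ∙-cong = λ p q k → +-cong (p k) (q k) }
            ; assoc = λ f g h k → +-assoc (f k) (g k) (h k) }
          ; identity = (λ f k → +-identityˡ (f k)) , (λ f k → +-identityʳ (f k)) }
        ; comm = λ f g k → +-comm (f k) (g k) }
      ; *-isCommutativeMonoid = record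
        { isMonoid = record
          { isSemigroup = record
            { isMagma = record { isEquivalence = ≋-isEquivalence ; ∙-cong = ⊛-cong }
            ; assoc = ⊛-assoc }
          ; identity = ⊛-identityˡ , ⊛-identityʳ }
        ; comm = ⊛-comm }
      ; distribʳ = ⊛-distribʳ
      ; zeroˡ = ⊛-zeroˡ } }

  ⊛-solves-linear : ∀ x x′ Q G → x + x′ ≈ 0# → G ≋ Q ⊕ delay 1 (x · G) →
                    (𝟙 ⊕ delay 1 (ι x′)) ⊛ G ≋ Q
  ⊛-solves-linear x x′ Q G x+x′≈0 G≋Q+xtG = begin
    (𝟙 ⊕ delay 1 (ι x′)) ⊛ G
      ≈⟨ ⊛-distribʳ G 𝟙 (delay 1 (ι x′)) ⟩
    𝟙 ⊛ G ⊕ delay 1 (ι x′) ⊛ G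
      ≈⟨ (λ k → +-cong (⊛-identityˡ G k) (monomial-⊛ 1 x′ G k)) ⟩
    G ⊕ delay 1 (x′ · G)
      ≈⟨ (λ k → +-congʳ (G≋Q+xtG k)) ⟩
    (Q ⊕ delay 1 (x · G)) ⊕ delay 1 (x′ · G)
      ≈⟨ (λ k → +-assoc (Q k) _ _) ⟩
    Q ⊕ (delay 1 (x · G) ⊕ delay 1 (x′ · G))
      ≈⟨ (λ k → +-congˡ (delay-⊕ 1 (x · G) (x′ · G) k)) ⟨
    Q ⊕ delay 1 (x · G ⊕ x′ · G)
      ≈⟨ (λ k → +-congˡ (delay-cong 1 cancel k)) ⟩
    Q ⊕ delay 1 𝟘
      ≈⟨ (λ k → trans (+-congˡ (delay-𝟘 1 k)) (+-identityʳ (Q k))) ⟩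
    Q ∎
    where
    open ≋-Reasoning
    cancel : x · G ⊕ x′ · G ≋ 𝟘
    cancel k = trans (sym (distribʳ (G k) x x′)) (trans (*-congʳ x+x′≈0) (zeroˡ (G k)))

  open import Algebra.Properties.Semiring.Sum (CommutativeSemiring.semiring ⊛-commutativeSemiring)
    public using () renaming (sum to ∑ₛ; sum-cong-≋ to ∑ₛ-cong; *-distribˡ-sum to ⊛-distribˡ-∑ₛ)

module ListSum {c ℓ} (R : CommutativeSemiring c ℓ) where

  open CommutativeSemiring R
  open import Algebra.Properties.CommutativeMonoid.Sum +-commutativeMonoid using (sum)
  open import Data.List.Properties using (map-upTo; map-∘)
  open import Data.Bool using (_≟_)
  open import Defs using (splitsℕ)

  sumₗ : List Carrier → Carrier
  sumₗ = foldr _+_ 0#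

  ⟦_⟧ : Bool → Carrier
  ⟦ b ⟧ = if b then 1# else 0#

  ⟦∧⟧ : ∀ a b → ⟦ a ∧ b ⟧ ≈ ⟦ a ⟧ * ⟦ b ⟧
  ⟦∧⟧ true b = sym (*-identityˡ ⟦ b ⟧)
  ⟦∧⟧ false b = sym (zeroˡ ⟦ b ⟧)

  sumₗ-++ : ∀ xs ys → sumₗ (xs ++ ys) ≈ sumₗ xs + sumₗ ys
  sumₗ-++ [] ys = sym (+-identityˡ _)
  sumₗ-++ (x ∷ xs) ys = trans (+-congˡ (sumₗ-++ xs ys)) (sym (+-assoc x _ _))

  sumₗ-concatMap : ∀ {A : Set} (f : A → List Carrier) xs →
                   sumₗ (concatMap f xs) ≈ sumₗ (map (λ x → sumₗ (f x)) xs)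
  sumₗ-concatMap f [] = refl
  sumₗ-concatMap f (x ∷ xs) = trans (sumₗ-++ (f x) _) (+-congˡ (sumₗ-concatMap f xs))

  sumₗ-cong : ∀ {A : Set} {f g : A → Carrier} xs → (∀ x → f x ≈ g x) →
              sumₗ (map f xs) ≈ sumₗ (map g xs)
  sumₗ-cong [] p = refl
  sumₗ-cong (x ∷ xs) p = +-cong (p x) (sumₗ-cong xs p)

  *-distribˡ-sumₗ : ∀ {A : Set} x (f : A → Carrier) xs →
                    x * sumₗ (map f xs) ≈ sumₗ (map (λ y → x * f y) xs)
  *-distribˡ-sumₗ x f [] = zeroʳ x
  *-distribˡ-sumₗ x f (y ∷ xs) = trans (distribˡ x _ _) (+-congˡ (*-distribˡ-sumₗ x f xs))

  *-distribʳ-sumₗ : ∀ {A : Set} x (f : A → Carrier) xs →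
                    sumₗ (map f xs) * x ≈ sumₗ (map (λ y → f y * x) xs)
  *-distribʳ-sumₗ x f xs =
    trans (*-comm _ x) (trans (*-distribˡ-sumₗ x f xs) (sumₗ-cong xs (λ y → *-comm x (f y))))

  sumₗ-applyUpTo : ∀ (f : ℕ → Carrier) n → sumₗ (applyUpTo f n) ≡ sum {n} (λ i → f (toℕ i))
  sumₗ-applyUpTo f zero = ≡.refl
  sumₗ-applyUpTo f (suc n) = ≡.cong (f 0 +_) (sumₗ-applyUpTo (f ∘ suc) n)

  sumₗ-upTo : ∀ (f : ℕ → Carrier) n → sumₗ (map f (upTo n)) ≡ sum {n} (λ i → f (toℕ i))
  sumₗ-upTo f n = ≡.trans (≡.cong sumₗ (map-upTo f n)) (sumₗ-applyUpTo f n)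

  sumₗ-splitsℕ : ∀ (h : ℕ × ℕ → Carrier) k →
                 sumₗ (map h (splitsℕ k)) ≡ sum {suc k} (λ i → h (toℕ i , k ∸ toℕ i))
  sumₗ-splitsℕ h k =
    ≡.trans (≡.cong sumₗ (≡.sym (map-∘ {g = h} {f = λ i → i , k ∸ i} (upTo (suc k)))))
            (sumₗ-upTo (λ i → h (i , k ∸ i)) (suc k))

  sumₗ-filter : ∀ {A : Set} (P : A → Bool) (f : A → Carrier) xs →
                sumₗ (map f (filter (λ x → P x ≟ true) xs)) ≈ sumₗ (map (λ x → ⟦ P x ⟧ * f x) xs)
  sumₗ-filter P f [] = refl
  sumₗ-filter P f (x ∷ xs) with P x
  ... | true = +-cong (sym (*-identityˡ (f x))) (sumₗ-filter P f xs)
  ... | false = trans (sumₗ-filter P f xs)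
                      (trans (sym (+-identityˡ _)) (+-congʳ (sym (zeroˡ (f x)))))

open import Defs
open import Data.Nat.ListAction using (sum)
import Data.Bool.Properties as Bool
import Data.List.Properties as List
open import Data.List.Relation.Unary.All as All using (All; []; _∷_)
import Data.List.Relation.Unary.All.Properties as All
open import Data.List.Relation.Unary.Unique.Propositional using (Unique)
open import Data.Vec as Vec using (Vec; []; _∷_; replicate; zipWith)
import Data.Vec.Properties as Vec
open import Data.Rational using (ℚ; 0ℚ; 1ℚ; _+_; _*_; -_)
import Data.Rational.Properties as ℚ
open import Function.Bundles using (Equivalence)
open ≡ using (refl; sym; trans; cong; cong₂; module ≡-Reasoning)
import Algebra.Properties.CommutativeSemigroup as CommutativeSemigroupProperties

ℚ-semiring : CommutativeSemiring 0ℓ 0ℓ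
ℚ-semiring = CommutativeRing.commutativeSemiring ℚ.+-*-commutativeRing

-- Polynomials in x are represented by their coefficient sequences.
module ℚ[x] = FormalPowerSeries ℚ-semiring
module ℚ[x][[t]] = FormalPowerSeries ℚ[x].⊛-commutativeSemiring
open ListSum ℚ-semiring
  using (⟦_⟧; ⟦∧⟧; sumₗ-concatMap; sumₗ-cong; *-distribˡ-sumₗ; *-distribʳ-sumₗ; sumₗ-splitsℕ)
module ℚ[x]ₗ = ListSum ℚ[x].⊛-commutativeSemiring
open CommutativeSemigroupProperties (CommutativeSemiring.*-commutativeSemigroup ℚ-semiring)
  using (interchange)
module ∧ = CommutativeSemigroupProperties (CommutativeMonoid.commutativeSemigroup Bool.∧-commutativeMonoid)

ℚ[x] : Set
ℚ[x] = ℚ[x].Series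

open ℚ[x] using (_≋_; _⊕_; _⊛_; _·_; 𝟘; 𝟙; ∑ₛ; ∑ₛ-cong; ≋-sym; ≋-trans)

x^_ : ℕ → ℚ[x]
x^ n = ℚ[x].monomial n 1ℚ

x^-apply : ∀ n e → (x^ n) e ≡ ⟦ ⌊ e ℕ.≟ n ⌋ ⟧
x^-apply n e = ℚ[x].monomial-apply n 1ℚ e

x^-⊛ : ∀ m n → x^ m ⊛ x^ n ≋ x^ (m ℕ.+ n)
x^-⊛ m n = ≋-trans (ℚ[x].monomial-⊛-monomial m 1ℚ n 1ℚ)
                   (ℚ[x].monomial-cong (m ℕ.+ n) (ℚ.*-identityˡ 1ℚ))

-- Polynomials with a single monomial in p

_+ᵥ_ : ∀ {r} → Vec ℕ r → Vec ℕ r → Vec ℕ r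
_+ᵥ_ = zipWith ℕ._+_

δ : ∀ {r} → Vec ℕ r → Vec ℕ r → ℚ
δ v u = ⟦ ⌊ v ≟V u ⌋ ⟧

δ-∷ : ∀ {r} x y (xs ys : Vec ℕ r) → δ (x ∷ xs) (y ∷ ys) ≡ (x^ y) x * δ xs ys
δ-∷ x y xs ys rewrite x^-apply y x with x ℕ.≟ y
... | no _ = sym (ℚ.*-zeroˡ (δ xs ys))
... | yes _ with xs ≟V ys
...   | yes _ = sym (ℚ.*-identityˡ 1ℚ)
...   | no _ = sym (ℚ.*-zeroʳ 1ℚ)

sum-splitsV-δ : ∀ {r} (v u u′ : Vec ℕ r) →
  sumℚ (map (λ p → δ (proj₁ p) u * δ (proj₂ p) u′) (splitsV v)) ≡ δ v (u +ᵥ u′)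
sum-splitsV-δ [] [] [] = refl
sum-splitsV-δ (x ∷ v) (a ∷ u) (b ∷ u′) = begin
  sumℚ (map T (concatMap F (splitsℕ x)))
    ≡⟨ cong sumℚ (List.map-concatMap T F (splitsℕ x)) ⟩
  sumℚ (concatMap (map T ∘ F) (splitsℕ x))
    ≡⟨ sumₗ-concatMap (map T ∘ F) (splitsℕ x) ⟩
  sumℚ (map (λ ij → sumℚ (map T (F ij))) (splitsℕ x))
    ≡⟨ sumₗ-cong (splitsℕ x) factor ⟩
  sumℚ (map (λ ij → (x^ a) (proj₁ ij) * (x^ b) (proj₂ ij) * D) (splitsℕ x))
    ≡⟨ *-distribʳ-sumₗ D (λ ij → (x^ a) (proj₁ ij) * (x^ b) (proj₂ ij)) (splitsℕ x) ⟨
  sumℚ (map (λ ij → (x^ a) (proj₁ ij) * (x^ b) (proj₂ ij)) (splitsℕ x)) * D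
    ≡⟨ cong (_* D) (trans (sumₗ-splitsℕ (λ ij → (x^ a) (proj₁ ij) * (x^ b) (proj₂ ij)) x) (x^-⊛ a b x)) ⟩
  (x^ (a ℕ.+ b)) x * D
    ≡⟨ δ-∷ x (a ℕ.+ b) v (u +ᵥ u′) ⟨
  δ (x ∷ v) ((a ∷ u) +ᵥ (b ∷ u′)) ∎
  where
  open ≡-Reasoning
  T : Vec ℕ _ × Vec ℕ _ → ℚ
  T p = δ (proj₁ p) (a ∷ u) * δ (proj₂ p) (b ∷ u′)
  F : ℕ × ℕ → List (Vec ℕ _ × Vec ℕ _)
  F (i , j) = map (λ p → (i ∷ proj₁ p) , (j ∷ proj₂ p)) (splitsV v)
  D : ℚ
  D = δ v (u +ᵥ u′)
  factor : ∀ ij → sumℚ (map T (F ij)) ≡ (x^ a) (proj₁ ij) * (x^ b) (proj₂ ij) * D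
  factor (i , j) = begin
    sumℚ (map T (F (i , j)))
      ≡⟨ cong sumℚ (List.map-∘ {g = T} {f = λ p → (i ∷ proj₁ p) , (j ∷ proj₂ p)} (splitsV v)) ⟨
    sumℚ (map (λ p → δ (i ∷ proj₁ p) (a ∷ u) * δ (j ∷ proj₂ p) (b ∷ u′)) (splitsV v))
      ≡⟨ sumₗ-cong (splitsV v) (λ p → trans (cong₂ _*_ (δ-∷ i a (proj₁ p) u) (δ-∷ j b (proj₂ p) u′))
                                              (interchange ((x^ a) i) (δ (proj₁ p) u) ((x^ b) j) (δ (proj₂ p) u′))) ⟩
    sumℚ (map (λ p → (x^ a) i * (x^ b) j * (δ (proj₁ p) u * δ (proj₂ p) u′)) (splitsV v))
      ≡⟨ *-distribˡ-sumₗ ((x^ a) i * (x^ b) j) (λ p → δ (proj₁ p) u * δ (proj₂ p) u′) (splitsV v) ⟨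
    (x^ a) i * (x^ b) j * sumℚ (map (λ p → δ (proj₁ p) u * δ (proj₂ p) u′) (splitsV v))
      ≡⟨ cong ((x^ a) i * (x^ b) j *_) (sum-splitsV-δ v u u′) ⟩
    (x^ a) i * (x^ b) j * D ∎

infix 5 _⊙_
_⊙_ : ∀ {r} → Vec ℕ r → ℚ[x] → Poly r
(u ⊙ X) v e = δ v u * X e

infix 4 _≐_
_≐_ : ∀ {r} → Poly r → Poly r → Set
f ≐ g = ∀ v e → f v e ≡ g v e

≐-trans : ∀ {r} {f g h : Poly r} → f ≐ g → g ≐ h → f ≐ h
≐-trans p q v e = trans (p v e) (q v e)

monoP-⊙ : ∀ {r} (u : Vec ℕ r) n → monoP u n ≐ u ⊙ x^ n
monoP-⊙ u n v e = trans (⟦∧⟧ ⌊ v ≟V u ⌋ ⌊ e ℕ.≟ n ⌋) (cong (δ v u *_) (sym (x^-apply n e)))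

⊙-cong : ∀ {r} (u : Vec ℕ r) {X Y} → X ≋ Y → u ⊙ X ≐ u ⊙ Y
⊙-cong u X≋Y v e = cong (δ v u *_) (X≋Y e)

negP-⊙ : ∀ {r} (u : Vec ℕ r) X → negP (u ⊙ X) ≐ u ⊙ (λ e → - X e)
negP-⊙ u X v e = ℚ.neg-distribʳ-* (δ v u) (X e)

*P-cong : ∀ {r} {f f′ g g′ : Poly r} → f ≐ f′ → g ≐ g′ → f *P g ≐ f′ *P g′
*P-cong f≐f′ g≐g′ v e = cong sumℚ (List.concatMap-cong
  (λ p → List.map-cong (λ ij → cong₂ _*_ (f≐f′ (proj₁ p) (proj₁ ij)) (g≐g′ (proj₂ p) (proj₂ ij)))
                       (splitsℕ e))
  (splitsV v))

*P-⊙ : ∀ {r} (u u′ : Vec ℕ r) X Y → (u ⊙ X) *P (u′ ⊙ Y) ≐ (u +ᵥ u′) ⊙ (X ⊛ Y)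
*P-⊙ u u′ X Y v e = begin
  sumℚ (concatMap (λ p → map (T p) (splitsℕ e)) (splitsV v))
    ≡⟨ sumₗ-concatMap (λ p → map (T p) (splitsℕ e)) (splitsV v) ⟩
  sumℚ (map (λ p → sumℚ (map (T p) (splitsℕ e))) (splitsV v))
    ≡⟨ sumₗ-cong (splitsV v) factor ⟩
  sumℚ (map (λ p → δ (proj₁ p) u * δ (proj₂ p) u′ * (X ⊛ Y) e) (splitsV v))
    ≡⟨ *-distribʳ-sumₗ ((X ⊛ Y) e) (λ p → δ (proj₁ p) u * δ (proj₂ p) u′) (splitsV v) ⟨
  sumℚ (map (λ p → δ (proj₁ p) u * δ (proj₂ p) u′) (splitsV v)) * (X ⊛ Y) e
    ≡⟨ cong (_* (X ⊛ Y) e) (sum-splitsV-δ v u u′) ⟩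
  δ v (u +ᵥ u′) * (X ⊛ Y) e ∎
  where
  open ≡-Reasoning
  T : _ → ℕ × ℕ → ℚ
  T p ij = (δ (proj₁ p) u * X (proj₁ ij)) * (δ (proj₂ p) u′ * Y (proj₂ ij))
  factor : ∀ p → sumℚ (map (T p) (splitsℕ e)) ≡ δ (proj₁ p) u * δ (proj₂ p) u′ * (X ⊛ Y) e
  factor (v₁ , v₂) = begin
    sumℚ (map (T (v₁ , v₂)) (splitsℕ e))
      ≡⟨ sumₗ-cong (splitsℕ e) (λ ij → interchange (δ v₁ u) (X (proj₁ ij)) (δ v₂ u′) (Y (proj₂ ij))) ⟩
    sumℚ (map (λ ij → δ v₁ u * δ v₂ u′ * (X (proj₁ ij) * Y (proj₂ ij))) (splitsℕ e))
      ≡⟨ *-distribˡ-sumₗ (δ v₁ u * δ v₂ u′) (λ ij → X (proj₁ ij) * Y (proj₂ ij)) (splitsℕ e) ⟨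
    δ v₁ u * δ v₂ u′ * sumℚ (map (λ ij → X (proj₁ ij) * Y (proj₂ ij)) (splitsℕ e))
      ≡⟨ cong (δ v₁ u * δ v₂ u′ *_) (sumₗ-splitsℕ (λ ij → X (proj₁ ij) * Y (proj₂ ij)) e) ⟩
    δ v₁ u * δ v₂ u′ * (X ⊛ Y) e ∎

sumP-⊙ : ∀ {r} {A : Set} (u : Vec ℕ r) {h : A → Poly r} {X : A → ℚ[x]} {as} →
         All (λ a → h a ≐ u ⊙ X a) as → sumP (map h as) ≐ u ⊙ ℚ[x]ₗ.sumₗ (map X as)
sumP-⊙ u [] v e = sym (ℚ.*-zeroʳ (δ v u))
sumP-⊙ u {X = X} {a ∷ as} (ha≐uXa ∷ hs≐uXs) v e =
  trans (cong₂ _+_ (ha≐uXa v e) (sumP-⊙ u hs≐uXs v e))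
        (sym (ℚ.*-distribˡ-+ (δ v u) (X a e) _))

*S-⊙ : ∀ {r} {f g : Series r} (u u′ : Vec ℕ r) {F G : ℚ[x][[t]].Series} →
       (∀ k → f k ≐ u ⊙ F k) → (∀ k → g k ≐ u′ ⊙ G k) →
       ∀ k → (f *S g) k ≐ (u +ᵥ u′) ⊙ (F ℚ[x][[t]].⊛ G) k
*S-⊙ {f = f} {g} u u′ {F} {G} f≐uF g≐u′G k v e =
  trans (sumP-⊙ (u +ᵥ u′) (All.universal (λ ij → ≐-trans (*P-cong (f≐uF (proj₁ ij)) (g≐u′G (proj₂ ij)))
                                           (*P-⊙ u u′ (F (proj₁ ij)) (G (proj₂ ij)))) (splitsℕ k)) v e)
        (cong (λ Z → δ v (u +ᵥ u′) * Z e) (ℚ[x]ₗ.sumₗ-splitsℕ (λ ij → F (proj₁ ij) ⊛ G (proj₂ ij)) k))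

-- ψ_m(F_a) as a sum over index sequences

colours : ∀ {r} → List (Letter r) → Vec ℕ r
colours {r} [] = replicate r 0
colours (l ∷ w) = unitV (proj₂ l) +ᵥ colours w

survives : ∀ {r} → ℕ → ℕ → Fin r → Bool
survives m i γ = (1 ≤ᵇ i) ∧ (i ≤ᵇ m) ∧ ((toℕ γ ≡ᵇ 0) ∨ (2 ≤ᵇ i))

allSurvive : ∀ {r} → ℕ → List (Letter r) → List ℕ → Bool
allSurvive m (a ∷ w) (i ∷ s) = survives m i (proj₂ a) ∧ allSurvive m w s
allSurvive m _ _ = true

weight : List ℕ → ℕ
weight [] = 0
weight (i ∷ s) = (i ∸ 1) ℕ.+ weight s

·x^-⊛-·x^ : ∀ c a d b → (c · x^ a) ⊛ (d · x^ b) ≋ (c * d) · x^ (a ℕ.+ b)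
·x^-⊛-·x^ c a d b = begin
  (c · x^ a) ⊛ (d · x^ b)  ≈⟨ ℚ[x].⊛-·ˡ c (x^ a) (d · x^ b) ⟩
  c · (x^ a ⊛ (d · x^ b))  ≈⟨ (λ e → cong (c *_) (ℚ[x].⊛-·ʳ d (x^ a) (x^ b) e)) ⟩
  c · d · (x^ a ⊛ x^ b)    ≈⟨ (λ e → sym (ℚ.*-assoc c d _)) ⟩
  (c * d) · (x^ a ⊛ x^ b)  ≈⟨ (λ e → cong ((c * d) *_) (x^-⊛ a b e)) ⟩
  (c * d) · x^ (a ℕ.+ b)   ∎
  where open ℚ[x].≋-Reasoning

ψvar-⊙ : ∀ {r} m i (γ : Fin r) → ψvar m i γ ≐ unitV γ ⊙ ⟦ survives m i γ ⟧ · x^ (i ∸ 1)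
ψvar-⊙ m i γ v e with survives m i γ
... | true = trans (monoP-⊙ (unitV γ) (i ∸ 1) v e) (cong (δ v (unitV γ) *_) (sym (ℚ.*-identityˡ _)))
... | false = trans (sym (ℚ.*-zeroʳ (δ v (unitV γ))))
                   (cong (δ v (unitV γ) *_) (sym (ℚ.*-zeroˡ ((x^ (i ∸ 1)) e))))

ψmon-⊙ : ∀ {r} m (w : List (Letter r)) s → length s ≡ length w →
         ψmon m w s ≐ colours w ⊙ ⟦ allSurvive m w s ⟧ · x^ (weight s)
ψmon-⊙ m [] [] _ = ≐-trans (monoP-⊙ _ 0) (⊙-cong _ λ e → sym (ℚ.*-identityˡ _))
ψmon-⊙ m (a ∷ w) (i ∷ s) |s|≡|w| =
  ≐-trans (*P-cong (ψvar-⊙ m i (proj₂ a)) (ψmon-⊙ m w s (ℕ.suc-injective |s|≡|w|)))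
  (≐-trans (*P-⊙ (unitV (proj₂ a)) (colours w) _ _)
           (⊙-cong (colours (a ∷ w)) (≋-trans (·x^-⊛-·x^ ⟦ sv ⟧ (i ∸ 1) ⟦ allSurvive m w s ⟧ (weight s))
             λ e → cong (_* (x^ weight (i ∷ s)) e) (sym (⟦∧⟧ sv (allSurvive m w s))))))
  where sv = survives m i (proj₂ a)

seqs-length : ∀ m n → All (λ s → length s ≡ n) (seqs m n)
seqs-length m zero = refl ∷ []
seqs-length m (suc n) =
  All.concat⁺ (All.map⁺ (All.universal (λ i → All.map⁺ {f = i ∷_} (All.map (cong suc) (seqs-length m n)))
                                       (map suc (upTo m))))

enum : ℕ → ℕ → (List ℕ → Bool) → ℚ[x]
enum m n P = ℚ[x]ₗ.sumₗ (map (λ s → ⟦ P s ⟧ · x^ (weight s)) (seqs m n))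

⟦⟧ₓ-⊛ : ∀ b c X → ℚ[x]ₗ.⟦ b ⟧ ⊛ (c · X) ≋ (⟦ b ⟧ * c) · X
⟦⟧ₓ-⊛ true c X = ≋-trans (ℚ[x].⊛-identityˡ (c · X)) (λ e → cong (_* X e) (sym (ℚ.*-identityˡ c)))
⟦⟧ₓ-⊛ false c X = ≋-trans (ℚ[x].⊛-zeroˡ (c · X))
                     (λ e → sym (trans (cong (_* X e) (ℚ.*-zeroˡ c)) (ℚ.*-zeroˡ (X e))))

ψF-⊙ : ∀ {r} m (a : List (Letter r)) →
       ψF m a ≐ colours a ⊙ enum m (length a) (λ s → compatible a s ∧ allSurvive m a s)
ψF-⊙ m a = ≐-trans
  (sumP-⊙ (colours a) (All.filter⁺ _ (All.map (λ {s} → ψmon-⊙ m a s) (seqs-length m (length a)))))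
  (⊙-cong (colours a) (≋-trans
    (ℚ[x]ₗ.sumₗ-filter (compatible a) (λ s → ⟦ allSurvive m a s ⟧ · x^ (weight s)) (seqs m (length a)))
    (ℚ[x]ₗ.sumₗ-cong (seqs m (length a)) (λ s →
      ≋-trans (⟦⟧ₓ-⊛ (compatible a s) _ _)
                   (λ e → cong (_* (x^ weight s) e) (sym (⟦∧⟧ (compatible a s) (allSurvive m a s))))))))

enum-suc : ∀ m n P → enum m (suc n) P ≋ ∑ₛ {m} (λ j → x^ (toℕ j) ⊛ enum m n (λ s → P (suc (toℕ j) ∷ s)))
enum-suc m n P = begin
  ℚ[x]ₗ.sumₗ (map F (concatMap G (map suc (upTo m))))
    ≡⟨ cong ℚ[x]ₗ.sumₗ (List.map-concatMap F G (map suc (upTo m))) ⟩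
  ℚ[x]ₗ.sumₗ (concatMap (map F ∘ G) (map suc (upTo m)))
    ≈⟨ ℚ[x]ₗ.sumₗ-concatMap (map F ∘ G) (map suc (upTo m)) ⟩
  ℚ[x]ₗ.sumₗ (map (λ i → ℚ[x]ₗ.sumₗ (map F (G i))) (map suc (upTo m)))
    ≡⟨ cong ℚ[x]ₗ.sumₗ (List.map-∘ (upTo m)) ⟨
  ℚ[x]ₗ.sumₗ (map (λ j → ℚ[x]ₗ.sumₗ (map F (G (suc j)))) (upTo m))
    ≡⟨ ℚ[x]ₗ.sumₗ-upTo (λ j → ℚ[x]ₗ.sumₗ (map F (G (suc j)))) m ⟩
  ∑ₛ {m} (λ j → ℚ[x]ₗ.sumₗ (map F (G (suc (toℕ j)))))
    ≈⟨ ∑ₛ-cong {m} (λ j → row (toℕ j)) ⟩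
  ∑ₛ {m} (λ j → x^ (toℕ j) ⊛ enum m n (λ s → P (suc (toℕ j) ∷ s))) ∎
  where
  open ℚ[x].≋-Reasoning
  F : List ℕ → ℚ[x]
  F s = ⟦ P s ⟧ · x^ (weight s)
  G : ℕ → List (List ℕ)
  G i = map (i ∷_) (seqs m n)
  row : ∀ j → ℚ[x]ₗ.sumₗ (map F (G (suc j))) ≋ x^ j ⊛ enum m n (λ s → P (suc j ∷ s))
  row j = begin
    ℚ[x]ₗ.sumₗ (map F (map (suc j ∷_) (seqs m n)))
      ≡⟨ cong ℚ[x]ₗ.sumₗ (List.map-∘ (seqs m n)) ⟨
    ℚ[x]ₗ.sumₗ (map (λ s → ⟦ P (suc j ∷ s) ⟧ · x^ (j ℕ.+ weight s)) (seqs m n))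
      ≈⟨ ℚ[x]ₗ.sumₗ-cong (seqs m n) (λ s → ≋-sym (≋-trans (ℚ[x].⊛-·ʳ ⟦ P (suc j ∷ s) ⟧ (x^ j) (x^ weight s))
                                                  (λ e → cong (⟦ P (suc j ∷ s) ⟧ *_) (x^-⊛ j (weight s) e)))) ⟩
    ℚ[x]ₗ.sumₗ (map (λ s → x^ j ⊛ F′ s) (seqs m n))
      ≈⟨ ℚ[x]ₗ.*-distribˡ-sumₗ (x^ j) F′ (seqs m n) ⟨
    x^ j ⊛ enum m n (λ s → P (suc j ∷ s)) ∎
    where
    F′ : List ℕ → ℚ[x]
    F′ s = ⟦ P (suc j ∷ s) ⟧ · x^ (weight s)

enum-cong : ∀ m n {P Q} → (∀ s → P s ≡ Q s) → enum m n P ≋ enum m n Q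
enum-cong m n P≡Q = ℚ[x]ₗ.sumₗ-cong (seqs m n) (λ s e → cong (λ b → ⟦ b ⟧ * (x^ weight s) e) (P≡Q s))

enum-∧ : ∀ m n b P → enum m n (λ s → b ∧ P s) ≋ ⟦ b ⟧ · enum m n P
enum-∧ m n b P e = begin
  ℚ[x]ₗ.sumₗ (map (λ s → ⟦ b ∧ P s ⟧ · x^ (weight s)) (seqs m n)) e
    ≡⟨ ℚ[x]ₗ.sumₗ-cong (seqs m n) (λ s k → trans (cong (_* (x^ weight s) k) (⟦∧⟧ b (P s)))
                                                  (ℚ.*-assoc ⟦ b ⟧ ⟦ P s ⟧ ((x^ weight s) k))) e ⟩
  ℚ[x]ₗ.sumₗ (map (λ s → ⟦ b ⟧ · ⟦ P s ⟧ · x^ (weight s)) (seqs m n)) e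
    ≡⟨ ·-sumₗ (seqs m n) ⟨
  ⟦ b ⟧ * enum m n P e ∎
  where
  open ≡-Reasoning
  ·-sumₗ : ∀ ss → (⟦ b ⟧ · ℚ[x]ₗ.sumₗ (map (λ s → ⟦ P s ⟧ · x^ (weight s)) ss)) e
                ≡ ℚ[x]ₗ.sumₗ (map (λ s → ⟦ b ⟧ · ⟦ P s ⟧ · x^ (weight s)) ss) e
  ·-sumₗ [] = ℚ.*-zeroʳ ⟦ b ⟧
  ·-sumₗ (s ∷ ss) =
    trans (ℚ.*-distribˡ-+ ⟦ b ⟧ _ _) (cong (⟦ b ⟧ * (⟦ P s ⟧ * (x^ weight s) e) +_) (·-sumₗ ss))

follows : ∀ {r} → Letter r → Letter r → ℕ → ℕ → Bool
follows a b i j = if b <c a then i <ᵇ j else i ≤ᵇ j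


uncoloured : ∀ {r} → Letter r → Bool
uncoloured a = toℕ (proj₂ a) ≡ᵇ 0

allowed : Bool → ℕ → Bool
allowed one? i = one? ∨ (2 ≤ᵇ i)

follows-suc : ∀ {r} (a b : Letter r) i j → follows a b (suc i) (suc j) ≡ follows a b i j
follows-suc a b i j with b <c a
... | true = refl
... | false with i
...   | zero = refl
...   | suc _ = refl

follows-to-1 : ∀ {r} (a b : Letter r) i → follows a b (suc (suc i)) 1 ≡ false
follows-to-1 a b i with b <c a
... | true = refl
... | false = refl

follows-from-1 : ∀ {r} (a b : Letter r) j → follows a b 1 (suc j) ≡ allowed (not (b <c a)) (suc j)
follows-from-1 a b j with b <c a
... | true = refl
... | false = refl

Cont : ∀ {r} → ℕ → Letter r → List (Letter r) → ℕ → ℚ[x]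
Cont m a w i = enum m (length w) (λ s → compatible (a ∷ w) (i ∷ s) ∧ allSurvive m w s)

enum-∷ : ∀ {r} m (a : Letter r) w →
  enum m (length (a ∷ w)) (λ s → compatible (a ∷ w) s ∧ allSurvive m (a ∷ w) s)
    ≋ ∑ₛ {m} (λ j → x^ (toℕ j) ⊛ (⟦ survives m (suc (toℕ j)) (proj₂ a) ⟧ · Cont m a w (suc (toℕ j))))
enum-∷ m a w = ≋-trans (enum-suc m (length w) (λ s → compatible (a ∷ w) s ∧ allSurvive m (a ∷ w) s))
  (∑ₛ-cong {m} λ j → ℚ[x].⊛-congˡ {x^ (toℕ j)} (≋-trans
    (enum-cong m (length w) (λ s → ∧.x∙yz≈y∙xz (co j s) (sv j) (allSurvive m w s)))
    (enum-∧ m (length w) (sv j) (λ s → co j s ∧ allSurvive m w s))))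
  where
  co : Fin m → List ℕ → Bool
  co j s = compatible (a ∷ w) (suc (toℕ j) ∷ s)
  sv : Fin m → Bool
  sv j = survives m (suc (toℕ j)) (proj₂ a)

enum-zero : ∀ m → enum m 0 (λ _ → true) ≋ 𝟙
enum-zero m e = trans (ℚ.+-identityʳ _) (ℚ.*-identityˡ _)

Cont-∷ : ∀ {r} m (a b : Letter r) w i →
  Cont m a (b ∷ w) i ≋
    ∑ₛ {m} (λ j → x^ (toℕ j) ⊛ (⟦ follows a b i (suc (toℕ j)) ∧ survives m (suc (toℕ j)) (proj₂ b) ⟧
                                 · Cont m b w (suc (toℕ j))))
Cont-∷ m a b w i =
  ≋-trans (enum-suc m (length w) (λ s → compatible (a ∷ b ∷ w) (i ∷ s) ∧ allSurvive m (b ∷ w) s))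
  (∑ₛ-cong {m} λ j → ℚ[x].⊛-congˡ {x^ (toℕ j)} (≋-trans
    (enum-cong m (length w) (λ s → ∧.interchange (fo j) (co j s) (sv j) (allSurvive m w s)))
    (enum-∧ m (length w) (fo j ∧ sv j) (λ s → co j s ∧ allSurvive m w s))))
  where
  co : Fin m → List ℕ → Bool
  co j s = compatible (b ∷ w) (suc (toℕ j) ∷ s)
  fo sv : Fin m → Bool
  fo j = follows a b i (suc (toℕ j))
  sv j = survives m (suc (toℕ j)) (proj₂ b)

-- Weight enumerators without the survival condition: Follow m a w i runs over the index sequences in
-- [1..m] for w that can follow the letter a placed at index i, Start m a w j over those for a ∷ w with
-- first index j + 1, and Starts m a w one? over those for a ∷ w whose first index is at least 2 unless one?.
mutual
  Follow : ∀ {r} → ℕ → Letter r → List (Letter r) → ℕ → ℚ[x]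
  Follow m a [] i = 𝟙
  Follow m a (b ∷ w) i = ∑ₛ {m} (λ j → ⟦ follows a b i (suc (toℕ j)) ⟧ · Start m b w (toℕ j))

  Start : ∀ {r} → ℕ → Letter r → List (Letter r) → ℕ → ℚ[x]
  Start m a w j = x^ j ⊛ Follow m a w (suc j)

Starts : ∀ {r} → ℕ → Letter r → List (Letter r) → Bool → ℚ[x]
Starts m a w one? = ∑ₛ {m} (λ j → ⟦ allowed one? (suc (toℕ j)) ⟧ · Start m a w (toℕ j))

survives-allowed : ∀ {r} m j (a : Letter r) → j ℕ.< m →
                   survives m (suc j) (proj₂ a) ≡ allowed (uncoloured a) (suc j)
survives-allowed m j a j<m rewrite Equivalence.to Bool.T-≡ (ℕ.<⇒<ᵇ j<m) = refl

-- Index 1 can only follow index 1 of an uncoloured letter, and then only weakly, i.e. by a letter of colour 0.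
allowed-follows : ∀ {r} (a b : Letter r) i j → allowed (uncoloured a) (suc i) ≡ true →
                  follows a b (suc i) (suc j) ≡ true → allowed (uncoloured b) (suc j) ≡ true
allowed-follows a b i j = lemma _ (toℕ (proj₂ a)) (toℕ (proj₂ b)) i j
  where
  lemma : ∀ X γ γ′ i j → ((γ ≡ᵇ 0) ∨ (2 ≤ᵇ suc i)) ≡ true →
          (if X ∨ (γ <ᵇ γ′) then suc i <ᵇ suc j else suc i ≤ᵇ suc j) ≡ true →
          ((γ′ ≡ᵇ 0) ∨ (2 ≤ᵇ suc j)) ≡ true
  lemma X γ zero i j _ _ = refl
  lemma X γ (suc γ′) i (suc j) _ _ = refl
  lemma X γ (suc γ′) (suc i) zero _ i<0 with X ∨ (γ <ᵇ suc γ′)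
  ... | true = i<0
  ... | false = i<0
  lemma true zero (suc γ′) zero zero _ 1<1 = 1<1
  lemma false zero (suc γ′) zero zero _ 1<1 = 1<1

⊛-guarded : ∀ f c X Y → (c ≡ true → X ≋ Y) → f ⊛ (⟦ c ⟧ · X) ≋ ⟦ c ⟧ · (f ⊛ Y)
⊛-guarded f false X Y _ =
  ≋-trans (ℚ[x].⊛-·ʳ 0ℚ f X) (λ e → trans (ℚ.*-zeroˡ ((f ⊛ X) e)) (sym (ℚ.*-zeroˡ ((f ⊛ Y) e))))
⊛-guarded f true X Y X≋Y =
  ≋-trans (ℚ[x].⊛-·ʳ 1ℚ f X) (λ e → cong (1ℚ *_) (ℚ[x].⊛-congˡ {f} (X≋Y refl) e))

Cont≋Follow : ∀ {r} m (a : Letter r) w i → allowed (uncoloured a) (suc i) ≡ true →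
              Cont m a w (suc i) ≋ Follow m a w (suc i)
Cont≋Follow m a [] i _ = enum-zero m
Cont≋Follow m a (b ∷ w) i a-ok =
  ≋-trans (Cont-∷ m a b w (suc i)) (∑ₛ-cong {m} λ j → summand (toℕ j) (Fin.toℕ<n j))
  where
  summand : ∀ j → j ℕ.< m →
    x^ j ⊛ (⟦ follows a b (suc i) (suc j) ∧ survives m (suc j) (proj₂ b) ⟧ · Cont m b w (suc j))
      ≋ ⟦ follows a b (suc i) (suc j) ⟧ · Start m b w j
  summand j j<m with follows a b (suc i) (suc j) in fo
  ... | false = ⊛-guarded (x^ j) false (Cont m b w (suc j)) (Follow m b w (suc j)) (λ ())
  ... | true rewrite survives-allowed m j b j<m | allowed-follows a b i j a-ok fo =
    ⊛-guarded (x^ j) true (Cont m b w (suc j)) (Follow m b w (suc j))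
              (λ _ → Cont≋Follow m b w j (allowed-follows a b i j a-ok fo))

enum≋Starts : ∀ {r} m (a : Letter r) w →
  enum m (length (a ∷ w)) (λ s → compatible (a ∷ w) s ∧ allSurvive m (a ∷ w) s) ≋ Starts m a w (uncoloured a)
enum≋Starts m a w = ≋-trans (enum-∷ m a w) (∑ₛ-cong {m} λ j → summand (toℕ j) (Fin.toℕ<n j))
  where
  summand : ∀ j → j ℕ.< m →
    x^ j ⊛ (⟦ survives m (suc j) (proj₂ a) ⟧ · Cont m a w (suc j))
      ≋ ⟦ allowed (uncoloured a) (suc j) ⟧ · Start m a w j
  summand j j<m rewrite survives-allowed m j a j<m =
    ⊛-guarded (x^ j) (allowed (uncoloured a) (suc j)) (Cont m a w (suc j)) (Follow m a w (suc j))
              (Cont≋Follow m a w j)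

-- Raising every index by one multiplies the weight of a sequence for w by x^(length w).
mutual
  Follow-shift : ∀ {r} m (a : Letter r) w j →
    Follow (suc m) a w (suc (suc j)) ≋ x^ (length w) ⊛ Follow m a w (suc j)
  Follow-shift m a [] j = ≋-sym (ℚ[x].⊛-identityˡ 𝟙)
  Follow-shift m a (b ∷ w) j = begin
    ⟦ f′ 1 ⟧ · Start (suc m) b w 0 ⊕ later
      ≈⟨ (λ e → cong (_+ later e) (trans (cong (λ c → ⟦ c ⟧ * Start (suc m) b w 0 e) (follows-to-1 a b j))
                                         (ℚ.*-zeroˡ (Start (suc m) b w 0 e)))) ⟩
    𝟘 ⊕ later
      ≈⟨ (λ e → ℚ.+-identityˡ (later e)) ⟩
    ∑ₛ {m} (λ k → ⟦ f′ (suc (suc (toℕ k))) ⟧ · Start (suc m) b w (suc (toℕ k)))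
      ≈⟨ ∑ₛ-cong {m} (λ k e → cong₂ (λ c X → ⟦ c ⟧ * X) (follows-suc a b (suc j) (suc (toℕ k)))
                                                      (Start-shift m b w (toℕ k) e)) ⟩
    ∑ₛ {m} (λ k → ⟦ f (toℕ k) ⟧ · (x^ n ⊛ Start m b w (toℕ k)))
      ≈⟨ ∑ₛ-cong {m} (λ k → ≋-sym (ℚ[x].⊛-·ʳ ⟦ f (toℕ k) ⟧ (x^ n) (Start m b w (toℕ k)))) ⟩
    ∑ₛ {m} (λ k → x^ n ⊛ (⟦ f (toℕ k) ⟧ · Start m b w (toℕ k)))
      ≈⟨ ℚ[x].⊛-distribˡ-∑ₛ {m} (x^ n) (λ k → ⟦ f (toℕ k) ⟧ · Start m b w (toℕ k)) ⟨
    x^ n ⊛ Follow m a (b ∷ w) (suc j) ∎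
    where
    open ℚ[x].≋-Reasoning
    n = suc (length w)
    f′ f : ℕ → Bool
    f′ = follows a b (suc (suc j))
    f k = follows a b (suc j) (suc k)
    later : ℚ[x]
    later = ∑ₛ {m} (λ k → ⟦ f′ (suc (suc (toℕ k))) ⟧ · Start (suc m) b w (suc (toℕ k)))

  Start-shift : ∀ {r} m (a : Letter r) w j →
    Start (suc m) a w (suc j) ≋ x^ (suc (length w)) ⊛ Start m a w j
  Start-shift m a w j = begin
    x^ (suc j) ⊛ Follow (suc m) a w (suc (suc j))  ≈⟨ ℚ[x].⊛-congˡ {x^ suc j} (Follow-shift m a w j) ⟩
    x^ (suc j) ⊛ (x^ (length w) ⊛ F)               ≈⟨ ℚ[x].⊛-assoc (x^ suc j) (x^ length w) F ⟨
    (x^ (suc j) ⊛ x^ (length w)) ⊛ F               ≈⟨ ℚ[x].⊛-congʳ {g = F} (x^-⊛ (suc j) (length w)) ⟩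
    x^ (suc j ℕ.+ length w) ⊛ F                    ≡⟨ cong (λ d → x^ suc d ⊛ F) (ℕ.+-comm j (length w)) ⟩
    x^ (suc (length w) ℕ.+ j) ⊛ F                  ≈⟨ ℚ[x].⊛-congʳ {g = F} (x^-⊛ (suc (length w)) j) ⟨
    (x^ (suc (length w)) ⊛ x^ j) ⊛ F               ≈⟨ ℚ[x].⊛-assoc (x^ suc (length w)) (x^ j) F ⟩
    x^ (suc (length w)) ⊛ Start m a w j            ∎
    where
    open ℚ[x].≋-Reasoning
    F = Follow m a w (suc j)

Starts-suc : ∀ {r} m (a : Letter r) w one? →
  Starts (suc m) a w one? ≋ ⟦ one? ⟧ · Start (suc m) a w 0 ⊕ x^ (suc (length w)) ⊛ Starts m a w true
Starts-suc m a w one? e = cong₂ _+_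
  (cong (λ c → ⟦ c ⟧ * Start (suc m) a w 0 e) (Bool.∨-identityʳ one?)) (shifted e)
  where
  n = suc (length w)
  shifted : ∑ₛ {m} (λ k → ⟦ one? ∨ true ⟧ · Start (suc m) a w (suc (toℕ k)))
              ≋ x^ n ⊛ Starts m a w true
  shifted = begin
    ∑ₛ {m} (λ k → ⟦ one? ∨ true ⟧ · Start (suc m) a w (suc (toℕ k)))
      ≈⟨ ∑ₛ-cong {m} (λ k e → cong₂ (λ c X → ⟦ c ⟧ * X) (Bool.∨-zeroʳ one?)
                                                      (Start-shift m a w (toℕ k) e)) ⟩
    ∑ₛ {m} (λ k → ⟦ true ⟧ · (x^ n ⊛ Start m a w (toℕ k)))
      ≈⟨ ∑ₛ-cong {m} (λ k → ≋-sym (ℚ[x].⊛-·ʳ 1ℚ (x^ n) (Start m a w (toℕ k)))) ⟩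
    ∑ₛ {m} (λ k → x^ n ⊛ (⟦ true ⟧ · Start m a w (toℕ k)))
      ≈⟨ ℚ[x].⊛-distribˡ-∑ₛ {m} (x^ n) (λ k → ⟦ true ⟧ · Start m a w (toℕ k)) ⟨
    x^ n ⊛ Starts m a w true ∎
    where open ℚ[x].≋-Reasoning

Start-zero-[] : ∀ {r} m (a : Letter r) → Start m a [] 0 ≋ 𝟙
Start-zero-[] m a = ℚ[x].⊛-identityˡ 𝟙

Start-zero-∷ : ∀ {r} m (a b : Letter r) w → Start m a (b ∷ w) 0 ≋ Starts m b w (not (b <c a))
Start-zero-∷ m a b w = ≋-trans (ℚ[x].⊛-identityˡ (Follow m a (b ∷ w) 1))
  (∑ₛ-cong {m} (λ k e → cong (λ c → ⟦ c ⟧ * Start m b w (toℕ k) e) (follows-from-1 a b (toℕ k))))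

-- Generating series in t

ℚ[x][[t]] : Set
ℚ[x][[t]] = ℚ[x][[t]].Series

open ℚ[x][[t]] using ()
  renaming (_≋_ to _≋ₜ_; _⊕_ to _⊕ₜ_; _⊛_ to _⊛ₜ_; _·_ to _·ₜ_; 𝟙 to 𝟙ₜ; ≋-refl to ≋ₜ-refl; ≋-trans to ≋ₜ-trans)

infix 8 t·_
t·_ : ℚ[x][[t]] → ℚ[x][[t]]
t·_ = ℚ[x][[t]].delay 1

Ψ : ∀ {r} → Letter r → List (Letter r) → Bool → ℚ[x][[t]]
Ψ a w one? k = Starts (suc k) a w one?

Ψstart : ∀ {r} → Letter r → List (Letter r) → ℚ[x][[t]]
Ψstart a w k = Start (suc k) a w 0

Ψ-unfold : ∀ {r} (a : Letter r) w one? k →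
  Ψ a w one? k ≋ (⟦ one? ⟧ · Ψstart a w k ⊕ (t· (x^ (suc (length w)) ·ₜ Ψ a w true)) k)
Ψ-unfold a w one? zero = ≋-trans (Starts-suc 0 a w one?)
  (λ e → cong (⟦ one? ⟧ * Start 1 a w 0 e +_) (ℚ[x].⊛-zeroʳ (x^ suc (length w)) e))
Ψ-unfold a w one? (suc k) = Starts-suc (suc k) a w one?

Ψ-true : ∀ {r} (a : Letter r) w → Ψ a w true ≋ₜ Ψstart a w ⊕ₜ t· (x^ (suc (length w)) ·ₜ Ψ a w true)
Ψ-true a w k = ≋-trans (Ψ-unfold a w true k)
  (λ e → cong (_+ (t· (x^ (suc (length w)) ·ₜ Ψ a w true)) k e) (ℚ.*-identityˡ (Start (suc k) a w 0 e)))

Ψ-false : ∀ {r} (a : Letter r) w → Ψ a w false ≋ₜ t· (x^ (suc (length w)) ·ₜ Ψ a w true)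
Ψ-false a w k = ≋-trans (Ψ-unfold a w false k)
  (λ e → trans (cong (_+ (t· (x^ (suc (length w)) ·ₜ Ψ a w true)) k e) (ℚ.*-zeroˡ (Start (suc k) a w 0 e)))
               (ℚ.+-identityˡ _))

-x^ : ℕ → ℚ[x]
-x^ i e = - (x^ i) e

1-xⁱt : ℕ → ℚ[x][[t]]
1-xⁱt i = 𝟙ₜ ⊕ₜ t· (ℚ[x][[t]].ι (-x^ i))

x^+-x^ : ∀ i → x^ i ⊕ -x^ i ≋ 𝟘
x^+-x^ i e = ℚ.+-inverseʳ ((x^ i) e)

den : ℕ → ℚ[x][[t]]
den n = foldr _⊛ₜ_ 𝟙ₜ (map 1-xⁱt (upTo (suc n)))

open import Algebra.Properties.CommutativeSemigroup
  (CommutativeSemiring.*-commutativeSemigroup ℚ[x][[t]].⊛-commutativeSemiring)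
  using () renaming (x∙yz≈y∙xz to ⊛ₜ-left-comm)

den-suc : ∀ n → den (suc n) ≋ₜ 1-xⁱt (suc n) ⊛ₜ den n
den-suc n = ≋ₜ-trans (λ k e → cong (λ P → P k e) unfold) (pull (map 1-xⁱt (upTo (suc n))))
  where
  unfold : den (suc n) ≡ foldr _⊛ₜ_ (1-xⁱt (suc n) ⊛ₜ 𝟙ₜ) (map 1-xⁱt (upTo (suc n)))
  unfold = begin
    foldr _⊛ₜ_ 𝟙ₜ (map 1-xⁱt (upTo (suc (suc n))))
      ≡⟨ cong (foldr _⊛ₜ_ 𝟙ₜ ∘ map 1-xⁱt) (List.upTo-∷ʳ (suc n)) ⟨
    foldr _⊛ₜ_ 𝟙ₜ (map 1-xⁱt (upTo (suc n) ++ [ suc n ]))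
      ≡⟨ cong (foldr _⊛ₜ_ 𝟙ₜ) (List.map-++ 1-xⁱt (upTo (suc n)) [ suc n ]) ⟩
    foldr _⊛ₜ_ 𝟙ₜ (map 1-xⁱt (upTo (suc n)) ++ [ 1-xⁱt (suc n) ])
      ≡⟨ List.foldr-++ _⊛ₜ_ 𝟙ₜ (map 1-xⁱt (upTo (suc n))) [ 1-xⁱt (suc n) ] ⟩
    foldr _⊛ₜ_ (1-xⁱt (suc n) ⊛ₜ 𝟙ₜ) (map 1-xⁱt (upTo (suc n))) ∎
    where open ≡-Reasoning
  pull : ∀ Fs → foldr _⊛ₜ_ (1-xⁱt (suc n) ⊛ₜ 𝟙ₜ) Fs ≋ₜ 1-xⁱt (suc n) ⊛ₜ foldr _⊛ₜ_ 𝟙ₜ Fs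
  pull [] = ≋ₜ-refl
  pull (F ∷ Fs) = ≋ₜ-trans (ℚ[x][[t]].⊛-congˡ {F} (pull Fs))
                                    (⊛ₜ-left-comm F (1-xⁱt (suc n)) (foldr _⊛ₜ_ 𝟙ₜ Fs))

ones : ℚ[x][[t]]
ones _ = 𝟙

1-xⁱt-⊛-ones : 1-xⁱt 0 ⊛ₜ ones ≋ₜ 𝟙ₜ
1-xⁱt-⊛-ones = ℚ[x][[t]].⊛-solves-linear (x^ 0) (-x^ 0) 𝟙ₜ ones (x^+-x^ 0) ones-unfold
  where
  ones-unfold : ones ≋ₜ 𝟙ₜ ⊕ₜ t· (x^ 0 ·ₜ ones)
  ones-unfold zero e = sym (ℚ.+-identityʳ _)
  ones-unfold (suc k) e = sym (trans (ℚ.+-identityˡ _) (ℚ[x].⊛-identityˡ 𝟙 e))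

ones-⊛-den : ones ⊛ₜ den 0 ≋ₜ 𝟙ₜ
ones-⊛-den = ≋ₜ-trans (ℚ[x][[t]].⊛-congˡ {ones} (ℚ[x][[t]].⊛-identityʳ (1-xⁱt 0)))
              (≋ₜ-trans (ℚ[x][[t]].⊛-comm ones (1-xⁱt 0)) 1-xⁱt-⊛-ones)

1-xⁿt-⊛-Ψ : ∀ {r} (a : Letter r) w → 1-xⁱt (suc (length w)) ⊛ₜ Ψ a w true ≋ₜ Ψstart a w
1-xⁿt-⊛-Ψ a w =
  ℚ[x][[t]].⊛-solves-linear (x^ n) (-x^ n) (Ψstart a w) (Ψ a w true) (x^+-x^ n) (Ψ-true a w)
  where n = suc (length w)

Ψstart-[] : ∀ {r} (a : Letter r) → Ψstart a [] ≋ₜ ones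
Ψstart-[] a k = Start-zero-[] (suc k) a

Ψstart-∷ : ∀ {r} (a b : Letter r) w → Ψstart a (b ∷ w) ≋ₜ Ψ b w (not (b <c a))
Ψstart-∷ a b w k = Start-zero-∷ (suc k) a b w

-- Descents

-- DesFrom (uncoloured a) (a ∷ w) is Des (a ∷ w).
DesFrom : ∀ {r} → Bool → List (Letter r) → List ℕ
DesFrom one? u = (if one? then [] else [ 0 ]) ++ DesStar u

desStarFrom-suc : ∀ {r} k (w : List (Letter r)) → desStarFrom (suc k) w ≡ map suc (desStarFrom k w)
desStarFrom-suc k [] = refl
desStarFrom-suc k (a ∷ []) = refl
desStarFrom-suc k (a ∷ b ∷ w) =
  trans (cong₂ _++_ (map-suc-if (b <c a)) (desStarFrom-suc (suc k) (b ∷ w)))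
        (sym (List.map-++ suc (if b <c a then [ k ] else []) (desStarFrom (suc k) (b ∷ w))))
  where
  map-suc-if : ∀ c → (if c then [ suc k ] else []) ≡ map suc (if c then [ k ] else [])
  map-suc-if true = refl
  map-suc-if false = refl

DesFrom-∷∷ : ∀ {r} (a b : Letter r) w → DesFrom true (a ∷ b ∷ w) ≡ map suc (DesFrom (not (b <c a)) (b ∷ w))
DesFrom-∷∷ a b w with b <c a
... | true = cong (1 ∷_) (desStarFrom-suc 1 (b ∷ w))
... | false = desStarFrom-suc 1 (b ∷ w)

desMonomial : ℕ → List ℕ → ℚ[x][[t]]
desMonomial n D = ℚ[x][[t]].monomial (length D) (x^ sum (map (n ∸_) D))

desMonomial-map-suc : ∀ n D → desMonomial n D ≡ desMonomial (suc n) (map suc D)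
desMonomial-map-suc n D =
  cong₂ (λ l s → ℚ[x][[t]].monomial l (x^ s)) (sym (List.length-map suc D)) (cong sum (List.map-∘ D))

desMonomial-∷0 : ∀ n D → t· (x^ n ·ₜ desMonomial n D) ≋ₜ desMonomial n (0 ∷ D)
desMonomial-∷0 n D = begin
  t· (x^ n ·ₜ ℚ[x][[t]].delay l (ℚ[x][[t]].ι (x^ Σ)))
    ≈⟨ ℚ[x][[t]].delay-cong 1 (ℚ[x][[t]].·-delay (x^ n) l (ℚ[x][[t]].ι (x^ Σ))) ⟩
  t· (ℚ[x][[t]].delay l (x^ n ·ₜ ℚ[x][[t]].ι (x^ Σ)))
    ≈⟨ ℚ[x][[t]].delay-cong 1 (ℚ[x][[t]].delay-cong l (ℚ[x][[t]].·-ι (x^ n) (x^ Σ))) ⟩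
  t· (ℚ[x][[t]].monomial l (x^ n ⊛ x^ Σ))
    ≈⟨ ℚ[x][[t]].delay-cong 1 (ℚ[x][[t]].monomial-cong l (x^-⊛ n Σ)) ⟩
  t· (ℚ[x][[t]].monomial l (x^ (n ℕ.+ Σ)))
    ≈⟨ ℚ[x][[t]].delay-+ 1 l (ℚ[x][[t]].ι (x^ (n ℕ.+ Σ))) ⟩
  desMonomial n (0 ∷ D) ∎
  where
  open ℚ[x][[t]].≋-Reasoning
  l = length D
  Σ = sum (map (n ∸_) D)

mutual
  Ψ-⊛-den : ∀ {r} w (a : Letter r) one? →
    Ψ a w one? ⊛ₜ den (suc (length w)) ≋ₜ desMonomial (suc (length w)) (DesFrom one? (a ∷ w))
  Ψ-⊛-den w a true = Ψtrue-⊛-den w a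
  Ψ-⊛-den w a false = begin
    Ψ a w false ⊛ₜ den n
      ≈⟨ ℚ[x][[t]].⊛-congʳ {g = den n} (Ψ-false a w) ⟩
    t· (x^ n ·ₜ Ψ a w true) ⊛ₜ den n
      ≈⟨ ℚ[x][[t]].delay-⊛ 1 (x^ n ·ₜ Ψ a w true) (den n) ⟩
    t· ((x^ n ·ₜ Ψ a w true) ⊛ₜ den n)
      ≈⟨ ℚ[x][[t]].delay-cong 1 (ℚ[x][[t]].⊛-·ˡ (x^ n) (Ψ a w true) (den n)) ⟩
    t· (x^ n ·ₜ (Ψ a w true ⊛ₜ den n))
      ≈⟨ ℚ[x][[t]].delay-cong 1 (λ k → ℚ[x].⊛-congˡ {x^ n} (Ψtrue-⊛-den w a k)) ⟩
    t· (x^ n ·ₜ desMonomial n (DesStar (a ∷ w)))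
      ≈⟨ desMonomial-∷0 n (DesStar (a ∷ w)) ⟩
    desMonomial n (DesFrom false (a ∷ w)) ∎
    where
    open ℚ[x][[t]].≋-Reasoning
    n = suc (length w)

  Ψtrue-⊛-den : ∀ {r} w (a : Letter r) →
    Ψ a w true ⊛ₜ den (suc (length w)) ≋ₜ desMonomial (suc (length w)) (DesStar (a ∷ w))
  Ψtrue-⊛-den w a = begin
    Ψ a w true ⊛ₜ den n
      ≈⟨ ℚ[x][[t]].⊛-congˡ {Ψ a w true} (den-suc (length w)) ⟩
    Ψ a w true ⊛ₜ (1-xⁱt n ⊛ₜ den (length w))
      ≈⟨ ⊛ₜ-left-comm (Ψ a w true) (1-xⁱt n) (den (length w)) ⟩
    1-xⁱt n ⊛ₜ (Ψ a w true ⊛ₜ den (length w))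
      ≈⟨ ℚ[x][[t]].⊛-assoc (1-xⁱt n) (Ψ a w true) (den (length w)) ⟨
    (1-xⁱt n ⊛ₜ Ψ a w true) ⊛ₜ den (length w)
      ≈⟨ ℚ[x][[t]].⊛-congʳ {g = den (length w)} (1-xⁿt-⊛-Ψ a w) ⟩
    Ψstart a w ⊛ₜ den (length w)
      ≈⟨ Ψstart-⊛-den w ⟩
    desMonomial n (DesStar (a ∷ w)) ∎
    where
    open ℚ[x][[t]].≋-Reasoning
    n = suc (length w)
    Ψstart-⊛-den : ∀ w → Ψstart a w ⊛ₜ den (length w) ≋ₜ desMonomial (suc (length w)) (DesStar (a ∷ w))
    Ψstart-⊛-den [] = ≋ₜ-trans (ℚ[x][[t]].⊛-congʳ {g = den 0} (Ψstart-[] a)) ones-⊛-den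
    Ψstart-⊛-den (b ∷ w) = begin
      Ψstart a (b ∷ w) ⊛ₜ den (suc (length w))
        ≈⟨ ℚ[x][[t]].⊛-congʳ {g = den (suc (length w))} (Ψstart-∷ a b w) ⟩
      Ψ b w (not (b <c a)) ⊛ₜ den (suc (length w))
        ≈⟨ Ψ-⊛-den w b (not (b <c a)) ⟩
      desMonomial (suc (length w)) (DesFrom (not (b <c a)) (b ∷ w))
        ≡⟨ desMonomial-map-suc (suc (length w)) (DesFrom (not (b <c a)) (b ∷ w)) ⟩
      desMonomial (suc (suc (length w))) (map suc (DesFrom (not (b <c a)) (b ∷ w)))
        ≡⟨ cong (desMonomial (suc (suc (length w)))) (DesFrom-∷∷ a b w) ⟨
      desMonomial (suc (suc (length w))) (DesStar (a ∷ b ∷ w)) ∎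

col≡colours : ∀ {r} (a : List (Letter r)) → col a ≡ colours a
col≡colours {r} a = trans (sym (Vec.tabulate∘lookup (col a)))
  (trans (Vec.tabulate-cong (λ j → trans (Vec.lookup∘tabulate _ j) (count a j)))
         (Vec.tabulate∘lookup (colours a)))
  where
  lookup-unitV : ∀ (γ j : Fin r) → Vec.lookup (unitV γ) j ≡ (if ⌊ γ Fin.≟ j ⌋ then 1 else 0)
  lookup-unitV γ j with γ Fin.≟ j
  ... | yes refl = Vec.lookup∘updateAt γ (replicate r 0)
  ... | no γ≢j = trans (Vec.lookup∘updateAt′ j γ (γ≢j ∘ sym) (replicate r 0)) (Vec.lookup-replicate j 0)
  lookup-+ᵥ : ∀ l a j → Vec.lookup (colours (l ∷ a)) j ≡ Vec.lookup (unitV (proj₂ l)) j ℕ.+ Vec.lookup (colours a) j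
  lookup-+ᵥ l a j = Vec.lookup-zipWith ℕ._+_ j (unitV (proj₂ l)) (colours a)
  count : ∀ (a : List (Letter r)) j → length (filter (λ l → proj₂ l Fin.≟ j) a) ≡ Vec.lookup (colours a) j
  count [] j = sym (Vec.lookup-replicate j 0)
  count (l ∷ a) j with proj₂ l Fin.≟ j | lookup-unitV (proj₂ l) j
  ... | yes _ | unit≡1 = trans (cong suc (count a j)) (sym (trans (lookup-+ᵥ l a j) (cong (ℕ._+ _) unit≡1)))
  ... | no _ | unit≡0 = trans (count a j) (sym (trans (lookup-+ᵥ l a j) (cong (ℕ._+ _) unit≡0)))

ΨF′ : ∀ {r} → List (Letter r) → ℚ[x][[t]]
ΨF′ [] = ones
ΨF′ (a ∷ w) = Ψ a w (uncoloured a)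

ΨF-⊙ : ∀ {r} (a : List (Letter r)) k → ΨF a k ≐ colours a ⊙ ΨF′ a k
ΨF-⊙ [] k = ≐-trans (ψF-⊙ (suc k) []) (⊙-cong (colours []) (enum-zero (suc k)))
ΨF-⊙ (a ∷ w) k = ≐-trans (ψF-⊙ (suc k) (a ∷ w)) (⊙-cong (colours (a ∷ w)) (enum≋Starts (suc k) a w))

ΨF′-⊛-den : ∀ {r} (a : List (Letter r)) → ΨF′ a ⊛ₜ den (length a) ≋ₜ desMonomial (length a) (Des a)
ΨF′-⊛-den [] = ones-⊛-den
ΨF′-⊛-den ((s , γ) ∷ w) = Ψ-⊛-den w (s , γ) (toℕ γ ≡ᵇ 0)

1-xⁱt-⊙ : ∀ {r} i k → oneMinusXiT {r} i k ≐ replicate r 0 ⊙ 1-xⁱt i k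
1-xⁱt-⊙ i zero = ≐-trans (monoP-⊙ _ 0) (⊙-cong _ λ e → sym (ℚ.+-identityʳ _))
1-xⁱt-⊙ i (suc zero) v e =
  trans (cong -_ (monoP-⊙ _ i v e)) (trans (negP-⊙ _ (x^ i) v e) (cong (δ v _ *_) (sym (ℚ.+-identityˡ _))))
1-xⁱt-⊙ {r} i (suc (suc k)) v e = sym (ℚ.*-zeroʳ (δ v (replicate r 0)))

denominator-⊙ : ∀ {r} n k → denominator {r} n k ≐ replicate r 0 ⊙ den n k
denominator-⊙ {r} n = product (upTo (suc n))
  where
  product : ∀ is k → foldr _*S_ 1S (map oneMinusXiT is) k ≐ replicate r 0 ⊙ foldr _⊛ₜ_ 𝟙ₜ (map 1-xⁱt is) k
  product [] zero = monoP-⊙ _ 0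
  product [] (suc k) v e = sym (ℚ.*-zeroʳ (δ v (replicate r 0)))
  product (i ∷ is) k v e = trans (*S-⊙ (replicate r 0) (replicate r 0) (1-xⁱt-⊙ i) (product is) k v e)
    (cong (λ u → δ v u * _) (trans (Vec.zipWith-replicate ℕ._+_ 0 0) refl))

⊙-desMonomial : ∀ {r} (u : Vec ℕ r) n D k → u ⊙ desMonomial n D k ≐ monoS u (sum (map (n ∸_) D)) (length D) k
⊙-desMonomial u n D k v e rewrite ℚ[x][[t]].monomial-apply (length D) (x^ sum (map (n ∸_) D)) k
  with k ℕ.≟ length D
... | yes _ = sym (monoP-⊙ u _ v e)
... | no _ = ℚ.*-zeroʳ (δ v u)

+ᵥ-replicate-0 : ∀ {r} (u : Vec ℕ r) → u +ᵥ replicate r 0 ≡ u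
+ᵥ-replicate-0 u =
  trans (Vec.zipWith-replicate₂ ℕ._+_ u 0) (trans (Vec.map-cong ℕ.+-identityʳ u) (Vec.map-id u))

proposition4p3 : (r : ℕ) → 1 ≤ r → (n : ℕ) → (a : List (Letter r)) → length a ≡ n
    → All (λ l → 1 ≤ proj₁ l) a → Unique (map proj₁ a)
    → (k : ℕ) (v : Vec ℕ r) (e : ℕ)
    → (ΨF a *S denominator n) k v e ≡ monoS (col a) (comaj a) (des a) k v e
proposition4p3 r _ .(length a) a refl _ _ k v e = begin
  (ΨF a *S denominator (length a)) k v e
    ≡⟨ *S-⊙ (colours a) (replicate r 0) (ΨF-⊙ a) (denominator-⊙ (length a)) k v e ⟩
  ((colours a +ᵥ replicate r 0) ⊙ (ΨF′ a ⊛ₜ den (length a)) k) v e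
    ≡⟨ cong (λ u → δ v u * (ΨF′ a ⊛ₜ den (length a)) k e)
            (trans (+ᵥ-replicate-0 (colours a)) (sym (col≡colours a))) ⟩
  (col a ⊙ (ΨF′ a ⊛ₜ den (length a)) k) v e
    ≡⟨ ⊙-cong (col a) (ΨF′-⊛-den a k) v e ⟩
  (col a ⊙ desMonomial (length a) (Des a) k) v e
    ≡⟨ ⊙-desMonomial (col a) (length a) (Des a) k v e ⟩
  monoS (col a) (comaj a) (des a) k v e ∎
  where open ≡-Reasoning
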